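{- Consider the variation of the graph discovery game in which the Discoverer does not learn the static edge set. Let $n,T_{\max}\in\mathbb{N}^+$, $k\in\{1,\dots,n\}$, $m\in\{1,\dots,\binom{n}{2}-n\}$ and $\delta\in\{1,\dots,T_{\max}\}$. Then there is an Adversary (using a graph with $m$ edges) such that any Discoverer algorithm winning this game variation on graphs with $n$ nodes must take at least $\lfloor nT_{\max}/(2\delta k)\rfloor$ rounds. This Adversary picks a graph with at most two $\delta$-edge connected components.
   Context: A simple temporal graph $(V,E,\lambda)$ with lifetime $T_{\max}$ is a finite simple undirected graph $(V,E)$ with labeling $\lambda\colon E\to\{1,\dots,T_{\max}\}$; edge $e$ exists only at time $\lambda(e)$. SIR model with parameter $\delta$: given seeds $S\subseteq V\times\{0,\dots,T_{\max}\}$, all nodes start susceptible; a seed $(v,t)$ infects $v$ at time $t$ (if susceptible); a susceptible node $u$ becomes infected at time $t$ iff a neighbor $v$ is infectious at time $t$ and $\lambda(uv)=t$ (by exactly one such neighbor); a node infected at time $t$ is infectious at $t+1,\dots,t+\delta$ and resistant afterwards. Infection logs record who infected whom when. Graph discovery game with unknown static graph, parameters $T_{\max},\delta,k,n$: the Adversary fixes $n$ nodes; the Discoverer learns only the node set. In each round the Discoverer submits at most $k$ seed infections and the Adversary answers with an infection log, adaptively choosing edges and labels but keeping all answers consistent with at least one temporal graph on $V$. When the Discoverer stops it submits a temporal graph; the Adversary wins if it can exhibit a different temporal graph on $V$ consistent with all logs, otherwise the Discoverer wins. $\delta$-edge connected components: link two edges sharing an endpoint whose labels differ by at most $\delta$;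 the classes of the transitive closure of this relation are the $\delta$-edge connected components. -}

module Defs where

open import Data.Nat using (ℕ; zero; suc; _+_; _*_; _≤_; _<_; _<ᵇ_; NonZero)
open import Data.Nat.Properties using (m*n≢0)
open import Data.Nat.DivMod using (_/_)
open import Data.Bool using (Bool; true; false; if_then_else_; _∧_)
open import Data.Fin using (Fin; toℕ)
open import Data.Maybe using (Maybe; just; nothing; is-just)
open import Data.List using (List; []; _∷_; length; map; cartesianProduct; allFin)
open import Data.Nat.ListAction using (sum)
open import Data.List.Membership.Propositional using (_∈_)
open import Data.List.Relation.Unary.All using (All)
open import Data.Product using (Σ; ∃; ∃-syntax; _×_; _,_)
open import Data.Sum using (_⊎_)
open import Relation.Binary.PropositionalEquality using (_≡_)
open import Relation.Binary.Construct.Closure.ReflexiveTransitive using (Star)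

-- Simple temporal graphs on the node set Fin n with lifetime T.
-- lab u v = just t  means: uv is an edge with label λ(uv) = t.
-- lab u v = nothing means: uv is not an edge.

record TemporalGraph (n T : ℕ) : Set where
  field
    lab    : Fin n → Fin n → Maybe ℕ
    sym    : ∀ u v → lab u v ≡ lab v u
    irrefl : ∀ u → lab u u ≡ nothing
    range  : ∀ u v t → lab u v ≡ just t → 1 ≤ t × t ≤ T
open TemporalGraph public

_≈G_ : ∀ {n T} → TemporalGraph n T → TemporalGraph n T → Set
G ≈G H = ∀ u v → lab G u v ≡ lab H u v

edgeIndicator : ∀ {n T} → TemporalGraph n T → Fin n × Fin n → ℕ
edgeIndicator G (u , v) =
  if (toℕ u <ᵇ toℕ v) ∧ is-just (lab G u v) then 1 else 0

edgeCount : ∀ {n T} → TemporalGraph n T → ℕ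
edgeCount {n} G = sum (map (edgeIndicator G) (cartesianProduct (allFin n) (allFin n)))

record Edge {n T : ℕ} (G : TemporalGraph n T) : Set where
  constructor edge
  field
    src  : Fin n
    tgt  : Fin n
    ord  : toℕ src < toℕ tgt
    time : ℕ
    isLb : lab G src tgt ≡ just time

ShareEndpoint : ∀ {n T} {G : TemporalGraph n T} → Edge G → Edge G → Set
ShareEndpoint e f =
  (Edge.src e ≡ Edge.src f) ⊎ (Edge.src e ≡ Edge.tgt f) ⊎
  (Edge.tgt e ≡ Edge.src f) ⊎ (Edge.tgt e ≡ Edge.tgt f)

δLinked : ∀ {n T} {G : TemporalGraph n T} → ℕ → Edge G → Edge G → Set
δLinked δ e f =
  ShareEndpoint e f × (Edge.time e ≤ Edge.time f + δ) × (Edge.time f ≤ Edge.time e + δ)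

-- at most two δ-edge connected components: every edge lies in the
-- transitive closure class of one of two edges e₁, e₂
-- (for graphs with at least one edge)
AtMostTwoδComponents : ∀ {n T} → ℕ → TemporalGraph n T → Set
AtMostTwoδComponents δ G =
  Σ (Edge G) λ e₁ → Σ (Edge G) λ e₂ →
    ∀ (f : Edge G) → Star (δLinked δ) e₁ f ⊎ Star (δLinked δ) e₂ f

Seeds : ℕ → Set
Seeds n = List (Fin n × ℕ)

data Source (n : ℕ) : Set where
  seed : Source n
  by   : Fin n → Source n

-- L v = just (t , s) : v was infected at time t by s;  nothing : never infected
Log : ℕ → Set
Log n = Fin n → Maybe (ℕ × Source n)

Infectious : ∀ {n} → ℕ → Log n → Fin n → ℕ → Set
Infectious δ L u t = ∃[ t₀ ] ∃[ s ] (L u ≡ just (t₀ , s) × t₀ < t × t ≤ t₀ + δ)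

InfectedBy : ∀ {n} → Log n → Fin n → ℕ → Set
InfectedBy L v t = ∃[ t' ] ∃[ s ] (L v ≡ just (t' , s) × t' ≤ t)

-- L is a possible infection log of the SIR process with parameter δ
-- on G started from seeds S
record ConsistentLog {n T : ℕ} (δ : ℕ) (G : TemporalGraph n T)
                     (S : Seeds n) (L : Log n) : Set where
  field
    seedCause  : ∀ v t → L v ≡ just (t , seed) → (v , t) ∈ S
    edgeCause  : ∀ v u t → L v ≡ just (t , by u) →
                 lab G u v ≡ just t × Infectious δ L u t
    seedFires  : ∀ v t → (v , t) ∈ S → InfectedBy L v t
    edgeFires  : ∀ u v t → lab G u v ≡ just t → Infectious δ L u t →
                 InfectedBy L v t

History : ℕ → Set
History n = List (Seeds n × Log n)

ConsistentHistory : ∀ {n T} → ℕ → TemporalGraph n T → History n → Set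
ConsistentHistory δ G h = All (λ p → ConsistentLog δ G (Data.Product.proj₁ p) (Data.Product.proj₂ p)) h

ValidSeeds : ∀ {n} → ℕ → ℕ → Seeds n → Set
ValidSeeds T k S = length S ≤ k × All (λ p → Data.Product.proj₂ p ≤ T) S

data Move (n T : ℕ) : Set where
  stop  : TemporalGraph n T → Move n T
  query : Seeds n → Move n T

-- a (deterministic) Discoverer only sees the node set and past logs
Discoverer : ℕ → ℕ → Set
Discoverer n T = History n → Move n T

ValidDiscoverer : ∀ {n T} → ℕ → Discoverer n T → Set
ValidDiscoverer {n} {T} k D = ∀ (h : History n) S → D h ≡ query S → ValidSeeds T k S

Adversary : ℕ → Set
Adversary n = History n → Seeds n → Log n

data Reachable {n : ℕ} (T k : ℕ) (A : Adversary n) : History n → Set where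
  start : Reachable T k A []
  step  : ∀ {h} S → Reachable T k A h → ValidSeeds T k S →
          Reachable T k A ((S , A h S) ∷ h)

ValidAdversary : (n T k δ m : ℕ) → Adversary n → Set
ValidAdversary n T k δ m A =
  ∀ h → Reachable T k A h →
    Σ (TemporalGraph n T) λ G →
      edgeCount G ≡ m × AtMostTwoδComponents δ G × ConsistentHistory δ G h

data Plays {n T : ℕ} (D : Discoverer n T) (A : Adversary n) : ℕ → History n → Set where
  start : Plays D A 0 []
  step  : ∀ {r h} S → Plays D A r h → D h ≡ query S →
          Plays D A (suc r) ((S , A h S) ∷ h)

DiscovererWins : ∀ {n T} → ℕ → TemporalGraph n T → History n → Set
DiscovererWins {n} {T} δ G h =
  ∀ (G' : TemporalGraph n T) → ConsistentHistory δ G' h → G' ≈G G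

roundBound : (n T δ k : ℕ) → .{{NonZero δ}} → .{{NonZero k}} → ℕ
roundBound n T δ k = (n * T) / (2 * δ * k)
  where instance
    _ = m*n≢0 (2 * δ) k
    _ = m*n≢0 2 δ

-- The Adversary fixes one graph G₀ whose m edges all carry the label T and avoid the n
-- "cycle" pairs {a, a + 1 mod n}; it answers every query with the SIR log on G₀. With all
-- labels equal to T, a node is infectious at a time j + 1 ≤ T only if it was seeded at some
-- t₀ with t₀ ≤ j < t₀ + δ. Call the pair (a, j) covered if a seed of this kind sits at a or
-- at a + 1. If (a, j) is uncovered, G₀ plus the edge {a, a + 1} labelled j + 1 produces
-- the same logs, so the Discoverer cannot have won. A seed covers at most 2δ of the n·T
-- pairs and a round has at most k seeds, so after r rounds a winner has 2δk·r ≥ n·T.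

module Submission where

open import Function using (_∘_)
open import Function.Definitions using (Injective)
open import Data.Empty using (⊥)
open import Data.Nat
open import Data.Nat.Properties
open import Data.Nat.Combinatorics using (_C_; nCk+nC[k+1]≡[n+1]C[k+1]; nC1≡n)
open import Data.Nat.DivMod using (_/_; /-monoˡ-≤; m*n/n≡m)
open import Data.Nat.ListAction using (sum)
open import Data.Nat.ListAction.Properties using (sum-++)
open import Data.Bool using (Bool; true; false; _∧_; _∨_; if_then_else_)
open import Data.Bool.Properties using (¬-not; ∧-comm; ∨-comm; ∨-identityʳ)
open import Data.Maybe using (Maybe; just; nothing; is-just; maybe; _<∣>_)
import Data.Maybe as Maybe
import Data.Maybe.Properties as Maybeₚ
open import Data.Fin using (Fin; toℕ; fromℕ<; remQuot; combine) renaming (_≟_ to _≟ᶠ_)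
open import Data.Fin.Properties using (toℕ<n; toℕ-fromℕ<; toℕ-injective; any?; pigeonhole; combine-remQuot)
  renaming (<⇒≢ to <⇒≢ᶠ)
open import Data.List
  using (List; []; _∷_; _++_; length; map; applyUpTo; concatMap; lookup; tabulate; allFin; cartesianProduct)
open import Data.List.Properties using (length-++; length-map; length-applyUpTo; map-++; map-∘; map-cong; map-tabulate)
open import Data.List.Membership.Propositional using (_∈_; _∉_)
open import Data.List.Membership.Propositional.Properties using (∈-map⁺; ∈-applyUpTo⁺; ∈-++⁺ˡ; ∈-++⁺ʳ; ∈-concat⁺′)
import Data.List.Membership.DecPropositional as DecMembership
open import Data.List.Relation.Unary.All using (All; []; _∷_)
open import Data.List.Relation.Unary.Any using (here; there; index)
open import Data.List.Relation.Unary.Any.Properties using (lookup-index)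
open import Data.Product using (Σ; ∃; ∃-syntax; _×_; _,_; proj₁; proj₂; uncurry)
import Data.Product as Product
import Data.Product.Properties as Productₚ
open import Data.Sum using (_⊎_; inj₁; inj₂)
open import Relation.Nullary using (Dec; yes; no; ¬_; _×-dec_; contradiction)
open import Relation.Nullary.Decidable using (⌊_⌋; decidable-stable)
open import Relation.Nullary.Reflects using (ofʸ; ofⁿ)
open import Relation.Binary.PropositionalEquality
open import Relation.Binary.Construct.Closure.ReflexiveTransitive using (Star; ε; _◅_; _◅◅_)
open import Defs hiding (sym)

open DecMembership (Productₚ.≡-dec _≟_ _≟_) using (_∈?_)

⟦_⟧ : Bool → ℕ
⟦ b ⟧ = if b then 1 else 0

sumBelow : ℕ → (ℕ → ℕ) → ℕ
sumBelow zero    f = 0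
sumBelow (suc n) f = sumBelow n f + f n

sumBelow-suc : ∀ n f → sumBelow (suc n) f ≡ f 0 + sumBelow n (f ∘ suc)
sumBelow-suc zero    f = +-comm 0 (f 0)
sumBelow-suc (suc n) f rewrite sumBelow-suc n f = +-assoc (f 0) _ _

sumBelow-cong : ∀ n {f g} → (∀ i → i < n → f i ≡ g i) → sumBelow n f ≡ sumBelow n g
sumBelow-cong zero    eq = refl
sumBelow-cong (suc n) eq = cong₂ _+_ (sumBelow-cong n (λ i i<n → eq i (m<n⇒m<1+n i<n))) (eq n ≤-refl)

sumBelow-monoˡ-≤ : ∀ f {m n} → m ≤ n → sumBelow m f ≤ sumBelow n f
sumBelow-monoˡ-≤ f {n = zero}  z≤n = z≤n
sumBelow-monoˡ-≤ f {m} {suc n} m≤1+n with m ≟ suc n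
... | yes refl = ≤-refl
... | no m≢1+n = ≤-trans (sumBelow-monoˡ-≤ f (≤-pred (≤∧≢⇒< m≤1+n m≢1+n))) (m≤m+n _ (f n))

inInterval : ℕ → ℕ → ℕ → Bool
inInterval lo c i = ⌊ lo ≤? i ⌋ ∧ ⌊ i <? lo + c ⌋

inInterval-sound : ∀ {lo c i} → inInterval lo c i ≡ true → lo ≤ i × i < lo + c
inInterval-sound {lo} {c} {i} eq with lo ≤? i | i <? lo + c
... | yes lo≤i | yes i<hi = lo≤i , i<hi

inInterval-complete : ∀ {lo c i} → lo ≤ i → i < lo + c → inInterval lo c i ≡ true
inInterval-complete {lo} {c} {i} lo≤i i<hi with lo ≤? i | i <? lo + c
... | yes _    | yes _    = refl
... | yes _    | no i≮hi = contradiction i<hi i≮hi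
... | no lo≰i | _        = contradiction lo≤i lo≰i

inInterval-below : ∀ {lo c i} → i < lo → inInterval lo c i ≡ false
inInterval-below {lo} {c} i<lo = ¬-not λ eq → <⇒≱ i<lo (proj₁ (inInterval-sound {lo} {c} eq))

inInterval-above : ∀ {lo c i} → lo + c ≤ i → inInterval lo c i ≡ false
inInterval-above {lo} {c} hi≤i = ¬-not λ eq → ≤⇒≯ hi≤i (proj₂ (inInterval-sound {lo} {c} eq))

sumBelow-inInterval : ∀ lo c N → sumBelow N (⟦_⟧ ∘ inInterval lo c) ≡ (N ⊓ (lo + c)) ∸ lo
sumBelow-inInterval lo c zero = sym (0∸n≡0 lo)
sumBelow-inInterval lo c (suc N) with lo ≤? N | N <? lo + c
... | no lo≰N | _ = begin
  sumBelow N _ + 0          ≡⟨ +-identityʳ _ ⟩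
  sumBelow N _              ≡⟨ sumBelow-inInterval lo c N ⟩
  (N ⊓ (lo + c)) ∸ lo       ≡⟨ m≤n⇒m∸n≡0 (≤-trans (m⊓n≤m N _) (<⇒≤ N<lo)) ⟩
  0                         ≡⟨ m≤n⇒m∸n≡0 (≤-trans (m⊓n≤m (suc N) _) N<lo) ⟨
  (suc N ⊓ (lo + c)) ∸ lo   ∎
  where open ≡-Reasoning
        N<lo = ≰⇒> lo≰N
... | yes lo≤N | yes N<hi = begin
  sumBelow N _ + 1          ≡⟨ cong (_+ 1) (sumBelow-inInterval lo c N) ⟩
  (N ⊓ (lo + c)) ∸ lo + 1   ≡⟨ cong (λ x → x ∸ lo + 1) (m≤n⇒m⊓n≡m (<⇒≤ N<hi)) ⟩
  N ∸ lo + 1                ≡⟨ +-∸-comm 1 lo≤N ⟨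
  (N + 1) ∸ lo              ≡⟨ cong (_∸ lo) (trans (+-comm N 1) (sym (m≤n⇒m⊓n≡m N<hi))) ⟩
  (suc N ⊓ (lo + c)) ∸ lo   ∎
  where open ≡-Reasoning
... | yes _ | no N≮hi = begin
  sumBelow N _ + 0          ≡⟨ +-identityʳ _ ⟩
  sumBelow N _              ≡⟨ sumBelow-inInterval lo c N ⟩
  (N ⊓ (lo + c)) ∸ lo       ≡⟨ cong (_∸ lo) (trans (m≥n⇒m⊓n≡n hi≤N) (sym (m≥n⇒m⊓n≡n (m≤n⇒m≤1+n hi≤N)))) ⟩
  (suc N ⊓ (lo + c)) ∸ lo   ∎
  where open ≡-Reasoning
        hi≤N = ≮⇒≥ N≮hi

sumBelow-inInterval-fits : ∀ lo c N → c ≤ N ∸ lo → sumBelow N (⟦_⟧ ∘ inInterval lo c) ≡ c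
sumBelow-inInterval-fits lo c N c≤N∸lo with lo ≤? N
... | yes lo≤N = begin
  sumBelow N (⟦_⟧ ∘ inInterval lo c) ≡⟨ sumBelow-inInterval lo c N ⟩
  (N ⊓ (lo + c)) ∸ lo                ≡⟨ cong (_∸ lo) (m≥n⇒m⊓n≡n hi≤N) ⟩
  (lo + c) ∸ lo                      ≡⟨ m+n∸m≡n lo c ⟩
  c                                  ∎
  where open ≡-Reasoning
        hi≤N = subst (lo + c ≤_) (m+[n∸m]≡n lo≤N) (+-monoʳ-≤ lo c≤N∸lo)
... | no lo≰N with n≤0⇒n≡0 (≤-trans c≤N∸lo (≤-reflexive (m≤n⇒m∸n≡0 (<⇒≤ (≰⇒> lo≰N)))))
...   | refl = trans (sumBelow-inInterval lo 0 N) (m≤n⇒m∸n≡0 (≤-trans (m⊓n≤n N (lo + 0)) (≤-reflexive (+-identityʳ lo))))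

sum-tabulate : ∀ n (f : ℕ → ℕ) → sum (tabulate {n = n} (f ∘ toℕ)) ≡ sumBelow n f
sum-tabulate zero    f = refl
sum-tabulate (suc n) f = trans (cong (f 0 +_) (sum-tabulate n (f ∘ suc))) (sym (sumBelow-suc n f))

sum-map-allFin : ∀ n (f : ℕ → ℕ) → sum (map (f ∘ toℕ) (allFin n)) ≡ sumBelow n f
sum-map-allFin n f = trans (cong sum (map-tabulate {n = n} (λ i → i) (f ∘ toℕ))) (sum-tabulate n f)

sum-map-cartesianProduct : ∀ {A B : Set} (f : A × B → ℕ) xs ys →
  sum (map f (cartesianProduct xs ys)) ≡ sum (map (λ x → sum (map (λ y → f (x , y)) ys)) xs)
sum-map-cartesianProduct f []       ys = refl
sum-map-cartesianProduct f (x ∷ xs) ys = begin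
  sum (map f (map (x ,_) ys ++ cartesianProduct xs ys))
    ≡⟨ cong sum (map-++ f (map (x ,_) ys) _) ⟩
  sum (map f (map (x ,_) ys) ++ map f (cartesianProduct xs ys))
    ≡⟨ sum-++ (map f (map (x ,_) ys)) _ ⟩
  sum (map f (map (x ,_) ys)) + sum (map f (cartesianProduct xs ys))
    ≡⟨ cong₂ _+_ (cong sum (sym (map-∘ ys))) (sum-map-cartesianProduct f xs ys) ⟩
  sum (map (λ y → f (x , y)) ys) + sum (map (λ x → sum (map (λ y → f (x , y)) ys)) xs) ∎
  where open ≡-Reasoning

sum-map-allFin² : ∀ n (f : Fin n × Fin n → ℕ) (g : ℕ → ℕ → ℕ) → (∀ u v → f (u , v) ≡ g (toℕ u) (toℕ v)) →
  sum (map f (cartesianProduct (allFin n) (allFin n))) ≡ sumBelow n (λ a → sumBelow n (g a))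
sum-map-allFin² n f g f≡g = begin
  sum (map f (cartesianProduct (allFin n) (allFin n)))
    ≡⟨ sum-map-cartesianProduct f (allFin n) (allFin n) ⟩
  sum (map (λ u → sum (map (λ v → f (u , v)) (allFin n))) (allFin n))
    ≡⟨ cong sum (map-cong (λ u → trans (cong sum (map-cong (f≡g u) (allFin n))) (sum-map-allFin n (g (toℕ u)))) (allFin n)) ⟩
  sum (map (λ u → sumBelow n (g (toℕ u))) (allFin n))
    ≡⟨ sum-map-allFin n (λ a → sumBelow n (g a)) ⟩
  sumBelow n (λ a → sumBelow n (g a)) ∎
  where open ≡-Reasoning

[n+2]C2≡[n+1]+[n+1]C2 : ∀ n → suc (suc n) C 2 ≡ suc n + suc n C 2
[n+2]C2≡[n+1]+[n+1]C2 n =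
  trans (sym (nCk+nC[k+1]≡[n+1]C[k+1] (suc n) 1)) (cong (_+ suc n C 2) (nC1≡n (suc n)))

sumBelow-[k∸i] : ∀ k j → k ≤ j → sumBelow j (k ∸_) ≡ suc k C 2
sumBelow-[k∸i] zero    j       _         = trans (sumBelow-cong j (λ i _ → 0∸n≡0 i)) (sumBelow-zero j)
  where
  sumBelow-zero : ∀ j → sumBelow j (λ _ → 0) ≡ 0
  sumBelow-zero zero    = refl
  sumBelow-zero (suc j) = trans (+-identityʳ _) (sumBelow-zero j)
sumBelow-[k∸i] (suc k) (suc j) (s≤s k≤j) = begin
  sumBelow (suc j) (suc k ∸_)   ≡⟨ sumBelow-suc j (suc k ∸_) ⟩
  suc k + sumBelow j (k ∸_)     ≡⟨ cong (suc k +_) (sumBelow-[k∸i] k j k≤j) ⟩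
  suc k + suc k C 2             ≡⟨ [n+2]C2≡[n+1]+[n+1]C2 k ⟨
  suc (suc k) C 2               ∎
  where open ≡-Reasoning

-- Row a lists the candidate edges {a, b} with a + 2 ≤ b < n, leaving out {0, n − 1}: these are
-- the pairs that are not consecutive on the cycle 0, 1, …, n − 1, and there are C(n,2) − n of them.
rowCapacity : ℕ → ℕ → ℕ
rowCapacity n zero    = n ∸ 3
rowCapacity n (suc a) = n ∸ (3 + a)

capacity : ℕ → ℕ
capacity n = sumBelow n (rowCapacity n)

[n]C2∸n≤capacity : ∀ n → n C 2 ∸ n ≤ capacity n
[n]C2∸n≤capacity 0 = z≤n
[n]C2∸n≤capacity 1 = z≤n
[n]C2∸n≤capacity 2 = z≤n
[n]C2∸n≤capacity (suc (suc (suc k))) = ≤-reflexive (begin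
  (3 + k) C 2 ∸ (3 + k)                       ≡⟨ cong (_∸ (3 + k)) (trans ([n+2]C2≡[n+1]+[n+1]C2 (suc k))
                                                  (cong (2 + k +_) ([n+2]C2≡[n+1]+[n+1]C2 k))) ⟩
  (2 + k + (1 + k + (1 + k) C 2)) ∸ (3 + k)   ≡⟨ cong (λ x → suc (suc x) ∸ (3 + k)) (+-suc k (k + (1 + k) C 2)) ⟩
  (3 + k + (k + (1 + k) C 2)) ∸ (3 + k)       ≡⟨ m+n∸m≡n (3 + k) _ ⟩
  k + (1 + k) C 2                             ≡⟨ cong (k +_) (sumBelow-[k∸i] k (2 + k) (m≤n+m k 2)) ⟨
  k + sumBelow (2 + k) (k ∸_)                 ≡⟨ sumBelow-suc (2 + k) (rowCapacity (3 + k)) ⟨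
  capacity (3 + k)                            ∎)
  where open ≡-Reasoning

1≤[n]C2∸n⇒4≤n : ∀ {n} → 1 ≤ n C 2 ∸ n → 4 ≤ n
1≤[n]C2∸n⇒4≤n {suc (suc (suc (suc _)))} _ = s≤s (s≤s (s≤s (s≤s z≤n)))

sucMod : ℕ → ℕ → ℕ
sucMod n a with suc a ≟ n
... | yes _ = 0
... | no  _ = suc a

predMod : ℕ → ℕ → ℕ
predMod n zero    = pred n
predMod n (suc b) = b

predMod-sucMod : ∀ {n a} → a < n → predMod n (sucMod n a) ≡ a
predMod-sucMod {n} {a} a<n with suc a ≟ n
... | yes refl = refl
... | no  _    = refl

sucMod<n : ∀ {n a} → a < n → sucMod n a < n
sucMod<n {n} {a} a<n with suc a ≟ n
... | yes _      = ≤-trans (s≤s z≤n) a<n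
... | no 1+a≢n = ≤∧≢⇒< a<n 1+a≢n

sucMod≢ : ∀ {n} a → 2 ≤ n → sucMod n a ≢ a
sucMod≢ {n} a 2≤n with suc a ≟ n
... | yes refl = <⇒≢ (≤-pred 2≤n)
... | no  _    = 1+n≢n

m⊓n+o⊓[m∸n]≡m⊓[n+o] : ∀ m n o → m ⊓ n + o ⊓ (m ∸ n) ≡ m ⊓ (n + o)
m⊓n+o⊓[m∸n]≡m⊓[n+o] m n o with m ≤? n
... | yes m≤n rewrite m≤n⇒m⊓n≡m m≤n | m≤n⇒m∸n≡0 m≤n | ⊓-zeroʳ o | m≤n⇒m⊓n≡m (≤-trans m≤n (m≤m+n n o)) =
  +-identityʳ m
... | no m≰n = begin
  m ⊓ n + o ⊓ (m ∸ n)      ≡⟨ cong (_+ o ⊓ (m ∸ n)) (m≥n⇒m⊓n≡n n≤m) ⟩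
  n + o ⊓ (m ∸ n)          ≡⟨ +-distribˡ-⊓ n o (m ∸ n) ⟩
  (n + o) ⊓ (n + (m ∸ n))  ≡⟨ cong ((n + o) ⊓_) (m+[n∸m]≡n n≤m) ⟩
  (n + o) ⊓ m              ≡⟨ ⊓-comm (n + o) m ⟩
  m ⊓ (n + o)              ∎
  where open ≡-Reasoning
        n≤m = <⇒≤ (≰⇒> m≰n)

if-just-inv : ∀ {A : Set} {x y : A} b → (if b then just x else nothing) ≡ just y → b ≡ true × x ≡ y
if-just-inv true refl = refl , refl

is-just-if : ∀ {A : Set} {x : A} b → is-just (if b then just x else nothing) ≡ b
is-just-if true  = refl
is-just-if false = refl

module ChosenGraph (n m : ℕ) where

  -- Rows are filled greedily in order, so a row is non-empty only if all earlier rows are full.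
  rowSize : ℕ → ℕ
  rowSize a = rowCapacity n a ⊓ (m ∸ sumBelow a (rowCapacity n))

  Forward : ℕ → ℕ → Bool
  Forward a = inInterval (a + 2) (rowSize a)

  Adjacent : ℕ → ℕ → Bool
  Adjacent a b = Forward a b ∨ Forward b a

  Forward-sound : ∀ {a b} → Forward a b ≡ true → a + 2 ≤ b × b < a + 2 + rowSize a
  Forward-sound {a} = inInterval-sound {a + 2} {rowSize a}

  Forward-below : ∀ a {b} → b < a + 2 → Forward a b ≡ false
  Forward-below a = inInterval-below {a + 2} {rowSize a}

  Forward-above : ∀ a {b} → a + 2 + rowSize a ≤ b → Forward a b ≡ false
  Forward-above a = inInterval-above {a + 2} {rowSize a}

  Adjacent≡Forward : ∀ {a b} → a < b → Adjacent a b ≡ Forward a b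
  Adjacent≡Forward {a} {b} a<b =
    trans (cong (Forward a b ∨_) (Forward-below b (≤-trans a<b (m≤m+n b 2)))) (∨-identityʳ _)

  ∧-Adjacent≡Forward : ∀ a b → (a <ᵇ b) ∧ Adjacent a b ≡ Forward a b
  ∧-Adjacent≡Forward a b with a <ᵇ b | <ᵇ-reflects-< a b
  ... | true  | ofʸ a<b = Adjacent≡Forward a<b
  ... | false | ofⁿ a≮b = sym (Forward-below a (≤-<-trans (≮⇒≥ a≮b) (m<m+n a (s≤s z≤n))))

  rowCapacity≤ : ∀ a → rowCapacity n a ≤ n ∸ (a + 2)
  rowCapacity≤ zero    = ∸-monoʳ-≤ n (n≤1+n 2)
  rowCapacity≤ (suc a) = ≤-reflexive (cong (n ∸_) (cong suc (+-comm 2 a)))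

  sumBelow-Forward : ∀ a → sumBelow n (⟦_⟧ ∘ Forward a) ≡ rowSize a
  sumBelow-Forward a = sumBelow-inInterval-fits (a + 2) (rowSize a) n (≤-trans (m⊓n≤m _ _) (rowCapacity≤ a))

  sumBelow-rowSize : ∀ j → sumBelow j rowSize ≡ m ⊓ sumBelow j (rowCapacity n)
  sumBelow-rowSize zero    = sym (⊓-zeroʳ m)
  sumBelow-rowSize (suc j) rewrite sumBelow-rowSize j =
    m⊓n+o⊓[m∸n]≡m⊓[n+o] m (sumBelow j (rowCapacity n)) (rowCapacity n j)

  Adjacent-suc : ∀ a → Adjacent a (suc a) ≡ false
  Adjacent-suc a = cong₂ _∨_ (Forward-below a (≤-reflexive (+-comm 2 a))) (Forward-below (suc a) (m≤m+n (suc a) 2))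

  Adjacent-sucMod : ∀ {a} → 3 ≤ n → a < n → Adjacent a (sucMod n a) ≡ false
  Adjacent-sucMod {a} 3≤n a<n with suc a ≟ n
  ... | no  _    = Adjacent-suc a
  ... | yes refl = cong₂ _∨_ (Forward-below a (≤-trans (s≤s z≤n) (m≤n+m 2 a))) (Forward-above 0 (begin
    2 + rowSize 0   ≤⟨ +-monoʳ-≤ 2 (m⊓n≤m (suc a ∸ 3) m) ⟩
    2 + (suc a ∸ 3) ≡⟨ +-∸-assoc 2 3≤n ⟨
    a               ∎))
    where open ≤-Reasoning

  sumBelow²-Forward : m ≤ capacity n → sumBelow n (λ a → sumBelow n (⟦_⟧ ∘ Forward a)) ≡ m
  sumBelow²-Forward m≤cap = begin
    sumBelow n (λ a → sumBelow n (⟦_⟧ ∘ Forward a)) ≡⟨ sumBelow-cong n (λ a _ → sumBelow-Forward a) ⟩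
    sumBelow n rowSize                             ≡⟨ sumBelow-rowSize n ⟩
    m ⊓ capacity n                                 ≡⟨ m≤n⇒m⊓n≡m m≤cap ⟩
    m                                              ∎
    where open ≡-Reasoning

  module _ {T : ℕ} (1≤T : 1 ≤ T) where

    label : ℕ → ℕ → Maybe ℕ
    label a b = if Adjacent a b then just T else nothing

    label-inv : ∀ {a b t} → label a b ≡ just t → Adjacent a b ≡ true × T ≡ t
    label-inv {a} {b} = if-just-inv (Adjacent a b)

    graph : TemporalGraph n T
    graph = record
      { lab    = λ u v → label (toℕ u) (toℕ v)
      ; sym    = λ u v → cong (λ x → if x then just T else nothing) (∨-comm (Forward (toℕ u) (toℕ v)) _)
      ; irrefl = λ u → cong (λ x → if x then just T else nothing) (cong₂ _∨_ (Forward-refl (toℕ u)) (Forward-refl (toℕ u)))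
      ; range  = λ u v t eq → subst (λ t → 1 ≤ t × t ≤ T) (proj₂ (label-inv {toℕ u} {toℕ v} eq)) (1≤T , ≤-refl)
      }
      where
      Forward-refl : ∀ a → Forward a a ≡ false
      Forward-refl a = Forward-below a (m<m+n a (s≤s z≤n))

    edgeCount-graph : m ≤ capacity n → edgeCount graph ≡ m
    edgeCount-graph m≤cap = trans
      (sum-map-allFin² n (edgeIndicator graph) (λ a b → ⟦ Forward a b ⟧)
         (λ u v → cong ⟦_⟧ (trans (cong ((toℕ u <ᵇ toℕ v) ∧_) (is-just-if (Adjacent (toℕ u) (toℕ v))))
                                   (∧-Adjacent≡Forward (toℕ u) (toℕ v)))))
      (sumBelow²-Forward m≤cap)

    graph-sucMod : ∀ {u v} → 3 ≤ n → toℕ v ≡ sucMod n (toℕ u) → lab graph u v ≡ nothing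
    graph-sucMod {u} 3≤n v≡ =
      cong (λ x → if x then just T else nothing)
           (trans (cong (Adjacent (toℕ u)) v≡) (Adjacent-sucMod 3≤n (toℕ<n u)))

    Edge-time : (e : Edge graph) → Edge.time e ≡ T
    Edge-time (edge u v _ _ eq) = sym (proj₂ (label-inv {toℕ u} {toℕ v} eq))

    Edge-Forward : (e : Edge graph) → Forward (toℕ (Edge.src e)) (toℕ (Edge.tgt e)) ≡ true
    Edge-Forward (edge u v u<v _ eq) = trans (sym (Adjacent≡Forward u<v)) (proj₁ (label-inv {toℕ u} {toℕ v} eq))

    edgeAt : ∀ {a b} → a < b → b < n → Forward a b ≡ true → Edge graph
    edgeAt {a} {b} a<b b<n eq = edge u v (subst₂ _<_ (sym (toℕ-fromℕ< _)) (sym (toℕ-fromℕ< _)) a<b) T uv≡T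
      where
      u v : Fin n
      u = fromℕ< (<-trans a<b b<n)
      v = fromℕ< b<n
      uv≡T : label (toℕ u) (toℕ v) ≡ just T
      uv≡T rewrite toℕ-fromℕ< (<-trans a<b b<n) | toℕ-fromℕ< b<n | Adjacent≡Forward a<b | eq = refl

    rowZero-full : ∀ {a b} → 1 ≤ a → Forward a b ≡ true → rowSize 0 ≡ n ∸ 3
    rowZero-full {a} {b} 1≤a eq = m≤n⇒m⊓n≡m (<⇒≤ (≤-<-trans (sumBelow-monoˡ-≤ (rowCapacity n) 1≤a) earlier<m))
      where
      0<rowSize : 0 < rowSize a
      0<rowSize with a+2≤b , b<end ← Forward-sound {a} {b} eq =
        +-cancelˡ-< (a + 2) 0 (rowSize a) (≤-<-trans (≤-trans (≤-reflexive (+-identityʳ (a + 2))) a+2≤b) b<end)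
      earlier<m : sumBelow a (rowCapacity n) < m
      earlier<m = m∸n≢0⇒n<m (λ eq0 → <⇒≢ (≤-trans 0<rowSize (m⊓n≤n _ _)) (sym eq0))

    module _ (δ : ℕ) (4≤n : 4 ≤ n) (1≤m : 1 ≤ m) where

      Linked : Edge graph → Edge graph → Set
      Linked = Star (δLinked δ)

      link : ∀ {e f} → ShareEndpoint e f → Linked e f
      link {e} {f} s = (s , within e f , within f e) ◅ ε
        where
        within : ∀ e f → Edge.time e ≤ Edge.time f + δ
        within e f = subst₂ (λ x y → x ≤ y + δ) (sym (Edge-time e)) (sym (Edge-time f)) (m≤m+n T δ)

      3≤n : 3 ≤ n
      3≤n = ≤-trans (n≤1+n 3) 4≤n

      Forward-rowZero : ∀ {b} → rowSize 0 ≡ n ∸ 3 → 2 ≤ b → suc b < n → Forward 0 b ≡ true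
      Forward-rowZero {b} full 2≤b 1+b<n = inInterval-complete {2} {rowSize 0} 2≤b (begin-strict
        b                <⟨ ∸-monoˡ-≤ 1 1+b<n ⟩
        n ∸ 1            ≡⟨ +-∸-assoc 2 3≤n ⟩
        2 + (n ∸ 3)      ≡⟨ cong (2 +_) full ⟨
        2 + rowSize 0    ∎)
        where open ≤-Reasoning

      e₁ : Edge graph
      e₁ = edgeAt {0} {2} (s≤s z≤n) 3≤n
             (inInterval-complete {2} {rowSize 0} ≤-refl (+-monoʳ-< 2 (⊓-pres-m< (∸-monoˡ-≤ 3 4≤n) 1≤m)))

      -- Every edge meets row 0 (full as soon as a later row is used), except possibly {1, n − 1};
      -- for n = 4 and m = 2 the graph is {0, 2}, {1, 3}, so two components are really needed.
      edgeOr-e₁ : ∀ x → Forward 1 (n ∸ 1) ≡ x → Edge graph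
      edgeOr-e₁ true  eq = edgeAt {1} {n ∸ 1} (∸-monoˡ-< {2} {1} 3≤n (s≤s z≤n))
                                  (∸-monoʳ-< {n} {1} {0} (s≤s z≤n) (≤-trans (s≤s z≤n) 3≤n)) eq
      edgeOr-e₁ false _  = e₁

      e₂ : Edge graph
      e₂ = edgeOr-e₁ _ refl

      sameSrc : ∀ {e f} → toℕ (Edge.src e) ≡ toℕ (Edge.src f) → Linked e f
      sameSrc eq = link (inj₁ (toℕ-injective eq))

      tgt≡src : ∀ {e f} → toℕ (Edge.tgt e) ≡ toℕ (Edge.src f) → Linked e f
      tgt≡src eq = link (inj₂ (inj₂ (inj₁ (toℕ-injective eq))))

      sameTgt : ∀ {e f} → toℕ (Edge.tgt e) ≡ toℕ (Edge.tgt f) → Linked e f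
      sameTgt eq = link (inj₂ (inj₂ (inj₂ (toℕ-injective eq))))

      e₂-reaches : ∀ x (eq : Forward 1 (n ∸ 1) ≡ x) → Forward 1 (n ∸ 1) ≡ true →
                   ∀ f → toℕ (Edge.src f) ≡ 1 → Linked (edgeOr-e₁ x eq) f
      e₂-reaches true  _  _      f a≡1 = sameSrc (trans (toℕ-fromℕ< _) (sym a≡1))
      e₂-reaches false eq isTrue f _   = contradiction (trans (sym eq) isTrue) λ ()

      reachLater : ∀ f → 1 ≤ toℕ (Edge.src f) → Linked e₁ f ⊎ Linked e₂ f
      reachLater f 1≤a = byCases (suc b <? n) (a ≟ 1)
        where
        a = toℕ (Edge.src f)
        b = toℕ (Edge.tgt f)
        full = rowZero-full 1≤a (Edge-Forward f)
        a+2≤b = proj₁ (Forward-sound {a} {b} (Edge-Forward f))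

        byCases : Dec (suc b < n) → Dec (a ≡ 1) → Linked e₁ f ⊎ Linked e₂ f
        byCases (yes 1+b<n) _ = inj₁ (sameSrc {e₁} {g} (trans (toℕ-fromℕ< _) (sym (toℕ-fromℕ< _)))
                                    ◅◅ sameTgt {g} {f} (toℕ-fromℕ< _))
          where
          2≤b = ≤-trans (m≤n+m 2 a) a+2≤b
          g = edgeAt {0} {b} (≤-trans (s≤s z≤n) 2≤b) (toℕ<n (Edge.tgt f)) (Forward-rowZero full 2≤b 1+b<n)
        byCases (no 1+b≮n) (yes a≡1) =
          inj₂ (e₂-reaches _ refl (subst₂ (λ x y → Forward x y ≡ true) a≡1 b≡n∸1 (Edge-Forward f)) f a≡1)
          where
          b≡n∸1 : b ≡ n ∸ 1
          b≡n∸1 = cong (_∸ 1) (≤-antisym (toℕ<n (Edge.tgt f)) (≮⇒≥ 1+b≮n))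
        byCases (no _) (no a≢1) = inj₁ (sameSrc {e₁} {g} (trans (toℕ-fromℕ< _) (sym (toℕ-fromℕ< _)))
                                      ◅◅ tgt≡src {g} {f} (toℕ-fromℕ< _))
          where
          2≤a = ≤∧≢⇒< 1≤a (a≢1 ∘ sym)
          2+a<n = ≤-<-trans (≤-trans (≤-reflexive (+-comm 2 a)) a+2≤b) (toℕ<n (Edge.tgt f))
          1+a<n = <-trans (n<1+n (suc a)) 2+a<n
          g = edgeAt {0} {a} (≤-trans (s≤s z≤n) 2≤a) (<-trans (n<1+n a) 1+a<n) (Forward-rowZero full 2≤a 1+a<n)

      graph-twoComponents : AtMostTwoδComponents δ graph
      graph-twoComponents = e₁ , e₂ , reach
        where
        reach : ∀ f → Linked e₁ f ⊎ Linked e₂ f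
        reach f with toℕ (Edge.src f) in a≡
        ... | zero  = inj₁ (sameSrc {e₁} {f} (trans (toℕ-fromℕ< _) (sym a≡)))
        ... | suc _ = reachLater f (subst (1 ≤_) (sym a≡) (s≤s z≤n))

earliestSeed : ∀ {n} → Seeds n → Fin n → Maybe ℕ
earliestSeed []            v = nothing
earliestSeed ((w , t) ∷ S) v with w ≟ᶠ v
... | yes _ = just (maybe (t ⊓_) t (earliestSeed S v))
... | no  _ = earliestSeed S v

earliestSeed-∈ : ∀ {n} (S : Seeds n) {v t} → earliestSeed S v ≡ just t → (v , t) ∈ S
earliestSeed-∈ ((w , t) ∷ S) {v} eq with w ≟ᶠ v
... | no  _    = there (earliestSeed-∈ S eq)
... | yes refl with earliestSeed S w in eqS | eq
...   | nothing | refl = here refl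
...   | just t′ | refl with ⊓-sel t t′
...     | inj₁ t⊓t′≡t  = here (cong (w ,_) t⊓t′≡t)
...     | inj₂ t⊓t′≡t′ = there (earliestSeed-∈ S (trans eqS (cong just (sym t⊓t′≡t′))))

earliestSeed-≤ : ∀ {n} (S : Seeds n) {v t} → (v , t) ∈ S → ∃[ t₀ ] earliestSeed S v ≡ just t₀ × t₀ ≤ t
earliestSeed-≤ ((w , t) ∷ S) (here refl) with w ≟ᶠ w
... | no w≢w = contradiction refl w≢w
... | yes _ with earliestSeed S w
...   | nothing = t , refl , ≤-refl
...   | just t′ = t ⊓ t′ , refl , m⊓n≤m t t′
earliestSeed-≤ ((w , t′) ∷ S) {v} (there v,t∈S) with w ≟ᶠ v | earliestSeed-≤ S v,t∈S
... | no  _ | ih = ih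
... | yes _ | t₀ , eq , t₀≤t rewrite eq = t′ ⊓ t₀ , refl , ≤-trans (m⊓n≤n t′ t₀) t₀≤t

module UniformLabelLog {n T : ℕ} (δ c : ℕ) (G : TemporalGraph n T)
                       (uniform : ∀ u v t → lab G u v ≡ just t → t ≡ c) where

  EarlyInfectious : Maybe ℕ → Set
  EarlyInfectious nothing   = ⊥
  EarlyInfectious (just t₀) = t₀ < c × c ≤ t₀ + δ

  earlyInfectious? : ∀ mo → Dec (EarlyInfectious mo)
  earlyInfectious? nothing   = no λ ()
  earlyInfectious? (just t₀) = t₀ <? c ×-dec c ≤? t₀ + δ

  module _ (S : Seeds n) where

    Spreader : Fin n → Fin n → Set
    Spreader v u = lab G u v ≡ just c × EarlyInfectious (earliestSeed S u)

    spreader? : ∀ v → Dec (∃ (Spreader v))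
    spreader? v = any? λ u → Maybeₚ.≡-dec _≟_ (lab G u v) (just c) ×-dec earlyInfectious? (earliestSeed S u)

    lateInfection : ∀ {v} → Maybe ℕ → Dec (∃ (Spreader v)) → Maybe (ℕ × Source n)
    lateInfection _  (yes (u , _)) = just (c , by u)
    lateInfection mo (no _)        = Maybe.map (_, seed) mo

    -- Before time c only seeds infect, so a node seeded before c is infected at its earliest seed.
    infection : ∀ {v} → Maybe ℕ → Dec (∃ (Spreader v)) → Maybe (ℕ × Source n)
    infection (just t₀) d with t₀ <? c
    ... | yes _ = just (t₀ , seed)
    ... | no  _ = lateInfection (just t₀) d
    infection nothing d = lateInfection nothing d

    sirLog : Log n
    sirLog v = infection (earliestSeed S v) (spreader? v)

    module _ {v : Fin n} where

      infection-seed : ∀ mo (d : Dec (∃ (Spreader v))) {t} → infection mo d ≡ just (t , seed) → mo ≡ just t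
      infection-seed (just t₀) d eq with t₀ <? c
      infection-seed (just t₀) d       refl | yes _ = refl
      infection-seed (just t₀) (no _)  refl | no  _ = refl
      infection-seed nothing   (no _)  ()

      infection-by : ∀ mo (d : Dec (∃ (Spreader v))) {t u} → infection mo d ≡ just (t , by u) →
                     t ≡ c × Spreader v u
      infection-by (just t₀) d eq with t₀ <? c
      infection-by (just t₀) (yes (u , sp)) refl | no _ = refl , sp
      infection-by nothing   (yes (u , sp)) refl = refl , sp

      infection-early : ∀ mo (d : Dec (∃ (Spreader v))) {t s} → infection mo d ≡ just (t , s) → t < c →
                        mo ≡ just t × s ≡ seed
      infection-early (just t₀) d eq t<c with t₀ <? c
      infection-early (just t₀) d       refl t<c | yes _   = refl , refl
      infection-early (just t₀) (yes _) refl c<c | no  _   = contradiction c<c (<-irrefl refl)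
      infection-early (just t₀) (no _)  refl t<c | no  t≮c = contradiction t<c t≮c
      infection-early nothing   (yes _) refl c<c = contradiction c<c (<-irrefl refl)

      infection-fromSeed : ∀ {t₀} (d : Dec (∃ (Spreader v))) → t₀ < c → infection (just t₀) d ≡ just (t₀ , seed)
      infection-fromSeed {t₀} d t₀<c with t₀ <? c
      ... | yes _    = refl
      ... | no t₀≮c = contradiction t₀<c t₀≮c

      infection-≤seed : ∀ {t₀} mo (d : Dec (∃ (Spreader v))) → mo ≡ just t₀ →
                        ∃[ t ] ∃[ s ] infection mo d ≡ just (t , s) × t ≤ t₀
      infection-≤seed (just t₀) d refl with t₀ <? c
      infection-≤seed (just t₀) d              refl | yes _    = t₀ , seed , refl , ≤-refl
      infection-≤seed (just t₀) (yes (u , _)) refl | no  t₀≮c = c , by u , refl , ≮⇒≥ t₀≮c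
      infection-≤seed (just t₀) (no _)        refl | no  _    = t₀ , seed , refl , ≤-refl

      infection-≤spread : ∀ mo (d : Dec (∃ (Spreader v))) → ∃ (Spreader v) →
                          ∃[ t ] ∃[ s ] infection mo d ≡ just (t , s) × t ≤ c
      infection-≤spread (just t₀) d sp with t₀ <? c
      infection-≤spread (just t₀) d             _  | yes t₀<c = t₀ , seed , refl , <⇒≤ t₀<c
      infection-≤spread (just t₀) (yes (u , _)) _  | no  _    = c , by u , refl , ≤-refl
      infection-≤spread (just t₀) (no ¬sp)      sp | no  _    = contradiction sp ¬sp
      infection-≤spread nothing   (yes (u , _)) _  = c , by u , refl , ≤-refl
      infection-≤spread nothing   (no ¬sp)      sp = contradiction sp ¬sp

    sirLog-early : ∀ {v t s} → sirLog v ≡ just (t , s) → t < c → earliestSeed S v ≡ just t × s ≡ seed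
    sirLog-early {v} = infection-early (earliestSeed S v) (spreader? v)

    earlyInfectious⇒Infectious : ∀ {u} → EarlyInfectious (earliestSeed S u) → Infectious δ sirLog u c
    earlyInfectious⇒Infectious {u} early with earliestSeed S u | early
    ... | just t₀ | t₀<c , c≤t₀+δ =
      t₀ , seed , infection-fromSeed (spreader? u) t₀<c , t₀<c , c≤t₀+δ

    sirLog-consistent : ConsistentLog δ G S sirLog
    sirLog-consistent = record
      { seedCause = λ v t eq → earliestSeed-∈ S (infection-seed (earliestSeed S v) (spreader? v) eq)
      ; edgeCause = edgeCause
      ; seedFires = seedFires
      ; edgeFires = edgeFires
      }
      where
      edgeCause : ∀ v u t → sirLog v ≡ just (t , by u) → lab G u v ≡ just t × Infectious δ sirLog u t
      edgeCause v u t eq with infection-by (earliestSeed S v) (spreader? v) eq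
      ... | refl , uv≡c , early = uv≡c , earlyInfectious⇒Infectious early

      seedFires : ∀ v t → (v , t) ∈ S → InfectedBy sirLog v t
      seedFires v t v,t∈S with t₀ , eq , t₀≤t ← earliestSeed-≤ S v,t∈S
                         with t′ , s , eq′ , t′≤t₀ ← infection-≤seed (earliestSeed S v) (spreader? v) eq =
        t′ , s , eq′ , ≤-trans t′≤t₀ t₀≤t

      edgeFires : ∀ u v t → lab G u v ≡ just t → Infectious δ sirLog u t → InfectedBy sirLog v t
      edgeFires u v t uv≡t (t₀ , s , eq , t₀<t , t≤t₀+δ) with uniform u v t uv≡t
      ... | refl with sirLog-early eq t₀<t
      ...   | eqS , refl = infection-≤spread (earliestSeed S v) (spreader? v)
                             (u , uv≡t , subst EarlyInfectious (sym eqS) (t₀<t , t≤t₀+δ))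

module AddEdge {n T : ℕ} (G : TemporalGraph n T) {u v : Fin n} (u≢v : u ≢ v)
               {t : ℕ} (1≤t : 1 ≤ t) (t≤T : t ≤ T) where

  IsPair : Fin n → Fin n → Bool
  IsPair x y = (⌊ x ≟ᶠ u ⌋ ∧ ⌊ y ≟ᶠ v ⌋) ∨ (⌊ x ≟ᶠ v ⌋ ∧ ⌊ y ≟ᶠ u ⌋)

  pairLabel : Fin n → Fin n → Maybe ℕ
  pairLabel x y = if IsPair x y then just t else nothing

  IsPair-sym : ∀ x y → IsPair x y ≡ IsPair y x
  IsPair-sym x y = trans (∨-comm (⌊ x ≟ᶠ u ⌋ ∧ ⌊ y ≟ᶠ v ⌋) _)
                         (cong₂ _∨_ (∧-comm ⌊ x ≟ᶠ v ⌋ ⌊ y ≟ᶠ u ⌋) (∧-comm ⌊ x ≟ᶠ u ⌋ ⌊ y ≟ᶠ v ⌋))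

  IsPair-irrefl : ∀ x → IsPair x x ≡ false
  IsPair-irrefl x with x ≟ᶠ u | x ≟ᶠ v
  ... | yes refl | yes refl = contradiction refl u≢v
  ... | yes _    | no  _    = refl
  ... | no  _    | yes _    = refl
  ... | no  _    | no  _    = refl

  IsPair-endpoint : ∀ x y → IsPair x y ≡ true → x ≡ u ⊎ x ≡ v
  IsPair-endpoint x y eq with x ≟ᶠ u | x ≟ᶠ v
  ... | yes x≡u | _       = inj₁ x≡u
  ... | no  _   | yes x≡v = inj₂ x≡v

  pairLabel-inv : ∀ x y {t′} → pairLabel x y ≡ just t′ → IsPair x y ≡ true × t ≡ t′
  pairLabel-inv x y eq with IsPair x y | eq
  ... | true | refl = refl , refl

  graph+edge : TemporalGraph n T
  graph+edge = record
    { lab    = λ x y → lab G x y <∣> pairLabel x y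
    ; sym    = λ x y → cong₂ _<∣>_ (TemporalGraph.sym G x y) (cong (λ b → if b then just t else nothing) (IsPair-sym x y))
    ; irrefl = λ x → cong₂ _<∣>_ (irrefl G x) (cong (λ b → if b then just t else nothing) (IsPair-irrefl x))
    ; range  = range+
    }
    where
    range+ : ∀ x y t′ → (lab G x y <∣> pairLabel x y) ≡ just t′ → 1 ≤ t′ × t′ ≤ T
    range+ x y t′ eq with lab G x y in xy≡
    ... | just _ with eq
    ...   | refl = range G x y t′ xy≡
    range+ x y t′ eq | nothing with pairLabel-inv x y eq
    ...   | _ , refl = 1≤t , t≤T

  graph+edge-new : lab G u v ≡ nothing → lab graph+edge u v ≡ just t
  graph+edge-new uv≡nothing rewrite uv≡nothing with u ≟ᶠ u | v ≟ᶠ v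
  ... | yes _ | yes _ = refl
  ... | no u≢u | _ = contradiction refl u≢u
  ... | yes _ | no v≢v = contradiction refl v≢v

  module _ {δ : ℕ} {S : Seeds n} {L : Log n} where

    graph+edge-consistent : ConsistentLog δ G S L → (∀ w → w ≡ u ⊎ w ≡ v → ¬ Infectious δ L w t) →
                            ConsistentLog δ graph+edge S L
    graph+edge-consistent consistent quiet = record
      { seedCause = seedCause
      ; edgeCause = λ y x t′ eq → let xy≡t′ , infectious = edgeCause y x t′ eq
                                  in cong (_<∣> pairLabel x y) xy≡t′ , infectious
      ; seedFires = seedFires
      ; edgeFires = edgeFires+
      }
      where
      open ConsistentLog consistent
      edgeFires+ : ∀ x y t′ → (lab G x y <∣> pairLabel x y) ≡ just t′ → Infectious δ L x t′ → InfectedBy L y t′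
      edgeFires+ x y t′ eq infectious with lab G x y in xy≡
      ... | just _ with eq
      ...   | refl = edgeFires x y t′ xy≡ infectious
      edgeFires+ x y t′ eq infectious | nothing with pairLabel-inv x y eq
      ...   | isPair , refl = contradiction infectious (quiet x (IsPair-endpoint x y isPair))

≤length-if-injection∈ : ∀ {A : Set} {N} (f : Fin N → A) → Injective _≡_ _≡_ f →
                        ∀ {ys} → (∀ i → f i ∈ ys) → N ≤ length ys
≤length-if-injection∈ f f-injective {ys} f∈ys = ≮⇒≥ λ length<N →
  let i , j , i<j , sameIndex = pigeonhole length<N (index ∘ f∈ys)
  in <⇒≢ᶠ i<j (f-injective (begin
       f i                         ≡⟨ lookup-index (f∈ys i) ⟩
       lookup ys (index (f∈ys i))  ≡⟨ cong (lookup ys) sameIndex ⟩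
       lookup ys (index (f∈ys j))  ≡⟨ lookup-index (f∈ys j) ⟨
       f j                         ∎))
  where open ≡-Reasoning

cell : ∀ {n} T → Fin (n * T) → ℕ × ℕ
cell {n} T = Product.map toℕ toℕ ∘ remQuot {n} T

cell-injective : ∀ {n} T → Injective _≡_ _≡_ (cell {n} T)
cell-injective {n} T {c} {c′} eq = begin
  c                                  ≡⟨ combine-remQuot {n} T c ⟨
  uncurry combine (remQuot {n} T c)  ≡⟨ cong (uncurry combine) (cong₂ _,_ (toℕ-injective (cong proj₁ eq))
                                                                          (toℕ-injective (cong proj₂ eq))) ⟩
  uncurry combine (remQuot {n} T c′) ≡⟨ combine-remQuot {n} T c′ ⟩
  c′                                 ∎
  where open ≡-Reasoning

length-concatMap-≤ : ∀ {A B : Set} (f : A → List B) {c} → (∀ x → length (f x) ≤ c) →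
                     ∀ xs → length (concatMap f xs) ≤ length xs * c
length-concatMap-≤ f f≤c []       = z≤n
length-concatMap-≤ f f≤c (x ∷ xs) = begin
  length (f x ++ concatMap f xs)        ≡⟨ length-++ (f x) ⟩
  length (f x) + length (concatMap f xs) ≤⟨ +-mono-≤ (f≤c x) (length-concatMap-≤ f f≤c xs) ⟩
  _ + length xs * _                      ∎
  where open ≤-Reasoning

∈-concatMap : ∀ {A B : Set} (f : A → List B) {x xs y} → x ∈ xs → y ∈ f x → y ∈ concatMap f xs
∈-concatMap f x∈xs y∈fx = ∈-concat⁺′ y∈fx (∈-map⁺ f x∈xs)

-- The cell (a, j) stands for adding the edge {a, a + 1 mod n} with label j + 1. A seed (w, t₀)
-- makes w infectious exactly at t₀ + 1, …, t₀ + δ, so it covers the cells of the two cycle pairs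
-- at w with t₀ ≤ j < t₀ + δ.
module Cover (n δ : ℕ) where

  window : ℕ → ℕ → List (ℕ × ℕ)
  window a t₀ = map (a ,_) (applyUpTo (t₀ +_) δ)

  seedCover : Fin n × ℕ → List (ℕ × ℕ)
  seedCover (w , t₀) = window (toℕ w) t₀ ++ window (predMod n (toℕ w)) t₀

  roundCover : Seeds n → List (ℕ × ℕ)
  roundCover = concatMap seedCover

  historyCover : History n → List (ℕ × ℕ)
  historyCover = concatMap (roundCover ∘ proj₁)

  length-window : ∀ a t₀ → length (window a t₀) ≡ δ
  length-window a t₀ = trans (length-map (a ,_) (applyUpTo (t₀ +_) δ)) (length-applyUpTo (t₀ +_) δ)

  length-seedCover : ∀ s → length (seedCover s) ≤ 2 * δ
  length-seedCover (w , t₀) = ≤-reflexive (begin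
    length (window (toℕ w) t₀ ++ window (predMod n (toℕ w)) t₀) ≡⟨ length-++ (window (toℕ w) t₀) ⟩
    length (window (toℕ w) t₀) + length (window _ t₀)         ≡⟨ cong₂ _+_ (length-window _ t₀) (length-window _ t₀) ⟩
    δ + δ                                                      ≡⟨ cong (δ +_) (+-identityʳ δ) ⟨
    2 * δ                                                      ∎)
    where open ≡-Reasoning

  ∈-window : ∀ {a t₀ j} → t₀ ≤ j → j < t₀ + δ → (a , j) ∈ window a t₀
  ∈-window {a} {t₀} {j} t₀≤j j<t₀+δ =
    subst (λ i → (a , i) ∈ window a t₀) (m+[n∸m]≡n t₀≤j)
          (∈-map⁺ (a ,_) (∈-applyUpTo⁺ (t₀ +_) (+-cancelˡ-< t₀ _ _ (subst (_< t₀ + δ) (sym (m+[n∸m]≡n t₀≤j)) j<t₀+δ))))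

  ∈-seedCover : ∀ {w a t₀ j} → a < n → toℕ w ≡ a ⊎ toℕ w ≡ sucMod n a → t₀ ≤ j → j < t₀ + δ →
                (a , j) ∈ seedCover (w , t₀)
  ∈-seedCover {w} a<n (inj₁ refl) t₀≤j j<t₀+δ = ∈-++⁺ˡ (∈-window t₀≤j j<t₀+δ)
  ∈-seedCover {w} {a} {t₀} {j} a<n (inj₂ w≡a⁺) t₀≤j j<t₀+δ =
    ∈-++⁺ʳ (window (toℕ w) t₀) (subst (λ x → (a , j) ∈ window x t₀) (sym (trans (cong (predMod n) w≡a⁺) (predMod-sucMod a<n)))
                                      (∈-window t₀≤j j<t₀+δ))

module LowerBound {n T k m δ : ℕ} .{{_ : NonZero k}} .{{_ : NonZero δ}}
                  (1≤T : 1 ≤ T) (4≤n : 4 ≤ n) (1≤m : 1 ≤ m) (m≤capacity : m ≤ capacity n) where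

  open ChosenGraph n m
  open Cover n δ

  G₀ : TemporalGraph n T
  G₀ = graph 1≤T

  open UniformLabelLog δ T G₀ (λ u v t eq → sym (proj₂ (label-inv 1≤T {toℕ u} {toℕ v} eq)))

  adversary : Adversary n
  adversary _ = sirLog

  Answered : History n → Set
  Answered = All (λ round → proj₂ round ≡ sirLog (proj₁ round))

  answered-consistent : ∀ {h} → Answered h → ConsistentHistory δ G₀ h
  answered-consistent []                              = []
  answered-consistent {(S , _) ∷ _} (refl ∷ answered) = sirLog-consistent S ∷ answered-consistent answered

  reachable-answered : ∀ {h} → Reachable T k adversary h → Answered h
  reachable-answered start        = []
  reachable-answered (step _ r _) = refl ∷ reachable-answered r

  plays-answered : ∀ {D : Discoverer n T} {r h} → Plays D adversary r h → Answered h
  plays-answered start        = []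
  plays-answered (step _ p _) = refl ∷ plays-answered p

  adversary-valid : ValidAdversary n T k δ m adversary
  adversary-valid h reachable =
    G₀ , edgeCount-graph 1≤T m≤capacity , graph-twoComponents 1≤T δ 4≤n 1≤m ,
    answered-consistent (reachable-answered reachable)

  length-historyCover : ∀ {D : Discoverer n T} → ValidDiscoverer k D → ∀ {r h} → Plays D adversary r h →
                        length (historyCover h) ≤ r * (k * (2 * δ))
  length-historyCover valid start = z≤n
  length-historyCover valid (step {h = h} S p D≡query) = begin
    length (roundCover S ++ historyCover h)         ≡⟨ length-++ (roundCover S) ⟩
    length (roundCover S) + length (historyCover h) ≤⟨ +-mono-≤ roundCover≤ (length-historyCover valid p) ⟩
    k * (2 * δ) + _                                 ∎
    where
    open ≤-Reasoning
    roundCover≤ : length (roundCover S) ≤ k * (2 * δ)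
    roundCover≤ = ≤-trans (length-concatMap-≤ seedCover length-seedCover S)
                          (*-monoˡ-≤ (2 * δ) (proj₁ (valid h S D≡query)))

  module Uncovered {a j : ℕ} (a<n : a < n) (j<T : j < T) where

    u v : Fin n
    u = fromℕ< a<n
    v = fromℕ< (sucMod<n a<n)

    toℕv≡sucMod : toℕ v ≡ sucMod n (toℕ u)
    toℕv≡sucMod = trans (toℕ-fromℕ< _) (cong (sucMod n) (sym (toℕ-fromℕ< a<n)))

    u≢v : u ≢ v
    u≢v u≡v = sucMod≢ (toℕ u) (≤-trans (s≤s (s≤s z≤n)) 4≤n) (trans (sym toℕv≡sucMod) (cong toℕ (sym u≡v)))

    open AddEdge G₀ u≢v (s≤s z≤n) j<T public

    quiet : ∀ S → (a , j) ∉ roundCover S → ∀ w → w ≡ u ⊎ w ≡ v → ¬ Infectious δ (sirLog S) w (suc j)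
    quiet S uncovered w endpoint (t₀ , s , eq , t₀<1+j , 1+j≤t₀+δ) =
      uncovered (∈-concatMap seedCover seeded (∈-seedCover a<n (toℕ-endpoint endpoint) (≤-pred t₀<1+j) 1+j≤t₀+δ))
      where
      seeded : (w , t₀) ∈ S
      seeded = earliestSeed-∈ S (proj₁ (sirLog-early S eq (≤-trans t₀<1+j j<T)))
      toℕ-endpoint : w ≡ u ⊎ w ≡ v → toℕ w ≡ a ⊎ toℕ w ≡ sucMod n a
      toℕ-endpoint (inj₁ refl) = inj₁ (toℕ-fromℕ< a<n)
      toℕ-endpoint (inj₂ refl) = inj₂ (toℕ-fromℕ< _)

    consistent+edge : ∀ {h} → Answered h → (a , j) ∉ historyCover h → ConsistentHistory δ graph+edge h
    consistent+edge [] _ = []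
    consistent+edge {(S , _) ∷ _} (refl ∷ answered) uncovered =
      graph+edge-consistent (sirLog-consistent S) (quiet S (uncovered ∘ ∈-++⁺ˡ))
      ∷ consistent+edge answered (uncovered ∘ ∈-++⁺ʳ (roundCover S))

    uv∉G₀ : lab G₀ u v ≡ nothing
    uv∉G₀ = graph-sucMod 1≤T (≤-trans (n≤1+n 3) 4≤n) toℕv≡sucMod

    labels-differ : lab graph+edge u v ≢ lab G₀ u v
    labels-differ eq with trans (sym (graph+edge-new uv∉G₀)) (trans eq uv∉G₀)
    ... | ()

  covered : ∀ {D : Discoverer n T} {r h G} → Plays D adversary r h → DiscovererWins δ G h →
            ∀ {a j} → a < n → j < T → (a , j) ∈ historyCover h
  covered plays wins {a} {j} a<n j<T = decidable-stable ((a , j) ∈? _) λ uncovered →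
    labels-differ (trans (wins graph+edge (consistent+edge answered uncovered) u v)
                         (sym (wins G₀ (answered-consistent answered) u v)))
    where open Uncovered a<n j<T
          answered = plays-answered plays

  n*T≤length-historyCover : ∀ {D : Discoverer n T} {r h G} → Plays D adversary r h → DiscovererWins δ G h →
                            n * T ≤ length (historyCover h)
  n*T≤length-historyCover {G = G} plays wins = ≤length-if-injection∈ (cell {n} T) (cell-injective {n} T) λ c →
    covered {G = G} plays wins (toℕ<n (proj₁ (remQuot {n} T c))) (toℕ<n (proj₂ (remQuot {n} T c)))

  lowerBound : ∀ (D : Discoverer n T) → ValidDiscoverer k D →
               ∀ r h G → Plays D adversary r h → D h ≡ stop G → DiscovererWins δ G h →
               roundBound n T δ k ≤ r
  lowerBound D valid r h G plays _ wins = begin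
    (n * T) / d        ≤⟨ /-monoˡ-≤ d (begin
      n * T                   ≤⟨ n*T≤length-historyCover {G = G} plays wins ⟩
      length (historyCover h) ≤⟨ length-historyCover valid plays ⟩
      r * (k * (2 * δ))       ≡⟨ cong (r *_) (*-comm k (2 * δ)) ⟩
      r * d                   ∎) ⟩
    (r * d) / d        ≡⟨ m*n/n≡m r d ⟩
    r                  ∎
    where
    open ≤-Reasoning
    d = 2 * δ * k
    instance
      _ = m*n≢0 2 δ
      _ = m*n≢0 (2 * δ) k

mainTheorem5 :
    ∀ (n T k m δ : ℕ) .{{_ : NonZero k}} .{{_ : NonZero δ}} →
      1 ≤ n → 1 ≤ T → k ≤ n → 1 ≤ m → m ≤ (n C 2) ∸ n → δ ≤ T →
      Σ (Adversary n) λ A →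
        ValidAdversary n T k δ m A ×
        (∀ (D : Discoverer n T) → ValidDiscoverer k D →
          ∀ r h G → Plays D A r h → D h ≡ stop G → DiscovererWins δ G h →
          roundBound n T δ k ≤ r)
mainTheorem5 n T k m δ _ 1≤T _ 1≤m m≤[n]C2∸n _ = adversary , adversary-valid , lowerBound
  where
  open LowerBound {n} {T} {k} {m} {δ} 1≤T (1≤[n]C2∸n⇒4≤n (≤-trans 1≤m m≤[n]C2∸n)) 1≤m
                  (≤-trans m≤[n]C2∸n ([n]C2∸n≤capacity n))
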